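{- Let $M$ be a supersolvable saturated matroid and let $H$ be a modular hyperplane of $M$ such that $M|H$ is supersolvable. Let $C^*=E(M)-H$ and $R=\operatorname{cl}(C^*)$. Then $R$ is a rotunda of $M$ and exactly one of the following holds: (a) $R\cap H$ is a rotunda of $M|H$ and $\mathcal{R}(M)=(\mathcal{R}(M|H)-\{R\cap H\})\cup\{R\}$; or (b) $R\cap H$ is properly contained in a rotunda of $M|H$ and $\mathcal{R}(M)=\mathcal{R}(M|H)\cup\{R\}$. Moreover, in case (a) the rotunda graph $R(M|H)$ is obtained from $R(M)$ by relabelling the vertex $R$ as $R\cap H$, and in case (b) $R(M|H)$ is obtained from $R(M)$ by deleting the vertex $R$.
   Context: A flat $F$ of a matroid $N$ is modular if $r(F)+r(F')=r(F\cap F')+r(F\cup F')$ for every flat $F'$ of $N$. A vertical cover of $N$ is a pair $(F,F')$ of flats, neither equal to $E(N)$, with $F\cup F'=E(N)$; it is a modular cover if both are modular flats of $N$. A set $X$ is round if $N|X$ has no vertical cover; a rotunda of $N$ is a maximal round flat, and $\mathcal{R}(N)$ is the set of rotunda. A rank-$r$ matroid is supersolvable if it has a chain of modular flats $F_0\subseteq\cdots\subseteq F_r$ with $r(F_i)=i$; saturated if every round flat is modular. For a supersolvable saturated $N$, the rotunda graph $R(N)$ has vertex set $\mathcal{R}(N)$, with distinct $R_1,R_2$ adjacent iff $R_1\cap R_2\neq\emptyset$ and there is a modular cover $(F_1,F_2)$ of $N$ with $R_i\subseteq F_i$ ($i=1,2$) and $F_1\cap F_2=R_1\cap R_2$. 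-}

module Defs where

open import Data.Nat using (ℕ; suc; _+_; _≤_; _≡ᵇ_)
open import Data.Bool using (Bool; _∧_)
open import Data.Fin using (Fin; toℕ) renaming (_≤_ to _≤ᶠ_)
open import Data.Fin.Subset using (Subset; _∈_; _∉_; _⊆_; _⊂_; _∩_; _∪_; _─_; ⁅_⁆; ∣_∣; Nonempty)
open import Data.Vec using (tabulate; lookup)
open import Data.Product using (Σ; _×_; ∃; ∃-syntax)
open import Data.Sum using (_⊎_)
open import Relation.Nullary using (¬_)
open import Relation.Binary.PropositionalEquality using (_≡_; _≢_)
open import Data.Nat using (_<_)

-- A (finite) matroid is given by a ground set E ⊆ Fin n together with a rank
-- function; only the values of rk on subsets of E are meaningful.
record Pre (n : ℕ) : Set where
  constructor mk
  field
    ground : Subset n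
    rk     : Subset n → ℕ
open Pre public

record IsMatroid {n : ℕ} (M : Pre n) : Set where
  field
    rk-bounded : ∀ X → X ⊆ ground M → rk M X ≤ ∣ X ∣
    rk-mono    : ∀ X Y → Y ⊆ ground M → X ⊆ Y → rk M X ≤ rk M Y
    rk-submod  : ∀ X Y → X ⊆ ground M → Y ⊆ ground M →
                 rk M (X ∪ Y) + rk M (X ∩ Y) ≤ rk M X + rk M Y

_∣ʳ_ : ∀ {n} → Pre n → Subset n → Pre n
M ∣ʳ X = mk X (rk M)

module _ {n : ℕ} (M : Pre n) where
  cl : Subset n → Subset n
  cl X = tabulate (λ e → lookup (ground M) e ∧ (rk M (X ∪ ⁅ e ⁆) ≡ᵇ rk M X))

  Flat : Subset n → Set
  Flat F = F ⊆ ground M × (∀ e → e ∈ ground M → e ∉ F → rk M F < rk M (F ∪ ⁅ e ⁆))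

  ModularFlat : Subset n → Set
  ModularFlat F = Flat F ×
    (∀ F' → Flat F' → rk M F + rk M F' ≡ rk M (F ∩ F') + rk M (F ∪ F'))

  Hyperplane : Subset n → Set
  Hyperplane H = Flat H × suc (rk M H) ≡ rk M (ground M)

  ModularHyperplane : Subset n → Set
  ModularHyperplane H = ModularFlat H × Hyperplane H

  VerticalCover : Subset n → Subset n → Set
  VerticalCover F F' = Flat F × Flat F' × F ≢ ground M × F' ≢ ground M
                       × F ∪ F' ≡ ground M

  ModularCover : Subset n → Subset n → Set
  ModularCover F F' = VerticalCover F F' × ModularFlat F × ModularFlat F'

  Supersolvable : Set
  Supersolvable = Σ (Fin (suc (rk M (ground M))) → Subset n) λ F →
    (∀ i → ModularFlat (F i)) × (∀ i → rk M (F i) ≡ toℕ i) ×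
    (∀ i j → i ≤ᶠ j → F i ⊆ F j)

Round : ∀ {n} → Pre n → Subset n → Set
Round M X = ¬ (∃[ F ] ∃[ F' ] VerticalCover (M ∣ʳ X) F F')

Saturated : ∀ {n} → Pre n → Set
Saturated M = ∀ X → Flat M X → Round M X → ModularFlat M X

Rotunda : ∀ {n} → Pre n → Subset n → Set
Rotunda M R = Flat M R × Round M R ×
  (∀ X → Flat M X → Round M X → R ⊆ X → X ≡ R)

-- adjacency in the rotunda graph R(N)
Adj : ∀ {n} → Pre n → Subset n → Subset n → Set
Adj N R₁ R₂ = Rotunda N R₁ × Rotunda N R₂ × R₁ ≢ R₂ × Nonempty (R₁ ∩ R₂) ×
  (∃[ F₁ ] ∃[ F₂ ] ModularCover N F₁ F₂ × R₁ ⊆ F₁ × R₂ ⊆ F₂ × F₁ ∩ F₂ ≡ R₁ ∩ R₂)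

open import Data.Vec.Properties using (≡-dec)
import Data.Bool as B
open import Relation.Nullary using (yes; no)

relabel : ∀ {n} → Subset n → Subset n → Subset n → Subset n
relabel R H X with ≡-dec B._≟_ X R
... | yes _ = R ∩ H
... | no _  = X

open import Function.Bundles using (_⇔_)

module _ {n : ℕ} (M : Pre n) (H : Subset n) where
  Rᶜ : Subset n
  Rᶜ = cl M (ground M ─ H)

  CaseA : Set
  CaseA = Rotunda (M ∣ʳ H) (Rᶜ ∩ H) ×
    (∀ X → Rotunda M X ⇔ ((Rotunda (M ∣ʳ H) X × X ≢ Rᶜ ∩ H) ⊎ X ≡ Rᶜ))

  CaseB : Set
  CaseB = (∃[ Y ] Rotunda (M ∣ʳ H) Y × Rᶜ ∩ H ⊂ Y) ×
    (∀ X → Rotunda M X ⇔ (Rotunda (M ∣ʳ H) X ⊎ X ≡ Rᶜ))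

  GraphA : Set
  GraphA = ∀ X Y → Rotunda M X → Rotunda M Y →
    Adj M X Y ⇔ Adj (M ∣ʳ H) (relabel Rᶜ H X) (relabel Rᶜ H Y)

  GraphB : Set
  GraphB = ∀ X Y → Rotunda M X → Rotunda M Y → X ≢ Rᶜ → Y ≢ Rᶜ →
    Adj M X Y ⇔ Adj (M ∣ʳ H) X Y

-- Modularity of the hyperplane H gives r F = 1 + r (F ∩ H) for every flat F ⊄ H,
-- and likewise for a union of flats spanned by points of H and one point off H;
-- hence a pair of flats meeting C* is modular exactly when their traces on H are.
-- R = cl C* is round: two points of C* span a line meeting H in positive rank,
-- and a vertical cover of M | R would have to swallow such a line.  Every round
-- flat meeting C* lies in R, so the rotunda of M are R and the rotunda of M | H
-- other than W = R ∩ H.  W is round, since a vertical cover (F , F′) of M | W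
-- lifts to the vertical cover (cl (F ∪ x₀) , cl (F′ ∪ x₀)) of M | R for a point
-- x₀ off H; so W is either a rotunda of M | H or properly inside one.  Modular
-- covers descend along F ↦ F ∩ H and lift along G ↦ cl (G ∪ x₀) on the side
-- containing the round set W, which matches the two rotunda graphs.

module Submission where

open import Defs
open import Data.Bool as Bool using (T)
open import Data.Bool.Properties using (T-∧; T-≡)
open import Data.Empty using (⊥-elim)
open import Data.Fin using (Fin)
open import Data.Fin.Properties using (any?; all?)
open import Data.Fin.Subset
  using (Subset; _∈_; _∉_; _⊆_; _⊂_; _∩_; _∪_; _─_; ⁅_⁆; ∣_∣; inside; outside)
  renaming (⊥ to ∅)
open import Data.Fin.Subset.Properties
open import Data.List using (List; []; _∷_; allFin)
open import Data.List.Membership.Propositional using () renaming (_∈_ to _∈ₗ_)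
open import Data.List.Membership.Propositional.Properties using (∈-allFin)
open import Data.List.Relation.Unary.Any using (here; there)
open import Data.Nat using (ℕ; zero; suc; _+_; _≤_; _<_; _<?_; s≤s)
open import Data.Nat.Properties
open import Data.Product using (_×_; _,_; proj₁; proj₂; ∃; ∃-syntax)
open import Data.Sum using (_⊎_; inj₁; inj₂; [_,_]) renaming (map to ⊎-map)
open import Data.Vec using (_∷_; here; there; lookup; tabulate)
open import Data.Vec.Properties using (lookup∘tabulate; []=⇒lookup; lookup⇒[]=; ≡-dec)
open import Function.Bundles using (_⇔_; mk⇔; Equivalence)
open import Function.Properties.Equivalence using () renaming (trans to ⇔-trans)
open import Level using (Level)
open import Relation.Binary.PropositionalEquality
  using (_≡_; _≢_; refl; sym; trans; cong; cong₂; subst; subst₂; module ≡-Reasoning)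
open import Relation.Nullary using (¬_; Dec; yes; no)
open import Relation.Nullary.Decidable using (decidable-stable; _×-dec_; _→-dec_; ¬?)
open import Relation.Unary using (Pred; Decidable)

private
  variable
    ℓ : Level
    n : ℕ
    A B C D : Subset n
    e : Fin n

-- Finite sets

_≟ₛ_ : (A B : Subset n) → Dec (A ≡ B)
_≟ₛ_ = ≡-dec Bool._≟_

∩-⊆ˡ : A ∩ B ⊆ A
∩-⊆ˡ = p∩q⊆p _ _

∩-⊆ʳ : A ∩ B ⊆ B
∩-⊆ʳ = p∩q⊆q _ _

⊆-∪ˡ : A ⊆ A ∪ B
⊆-∪ˡ = p⊆p∪q _

⊆-∪ʳ : B ⊆ A ∪ B
⊆-∪ʳ = q⊆p∪q _ _

∪-least : A ⊆ C → B ⊆ C → A ∪ B ⊆ C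
∪-least {A = A} {B = B} A⊆C B⊆C x∈A∪B = [ A⊆C , B⊆C ] (x∈p∪q⁻ A B x∈A∪B)

∪-mono : A ⊆ C → B ⊆ D → A ∪ B ⊆ C ∪ D
∪-mono A⊆C B⊆D = ∪-least (λ h → ⊆-∪ˡ (A⊆C h)) (λ h → ⊆-∪ʳ (B⊆D h))

∩-mono : A ⊆ C → B ⊆ D → A ∩ B ⊆ C ∩ D
∩-mono A⊆C B⊆D h = x∈p∩q⁺ (A⊆C (∩-⊆ˡ h) , B⊆D (∩-⊆ʳ h))

⊆-∪⇒⊆-∪∩ : A ⊆ B ∪ C → A ⊆ (B ∩ A) ∪ (C ∩ A)
⊆-∪⇒⊆-∪∩ {B = B} {C = C} A⊆B∪C e∈A =
  [ (λ e∈B → ⊆-∪ˡ (x∈p∩q⁺ (e∈B , e∈A))) , (λ e∈C → ⊆-∪ʳ (x∈p∩q⁺ (e∈C , e∈A))) ] (x∈p∪q⁻ B C (A⊆B∪C e∈A))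

∩-greatest : A ⊆ B → A ⊆ C → A ⊆ B ∩ C
∩-greatest A⊆B A⊆C x∈A = x∈p∩q⁺ (A⊆B x∈A , A⊆C x∈A)

p⊆q⇒p∩q≡p : A ⊆ B → A ∩ B ≡ A
p⊆q⇒p∩q≡p A⊆B = ⊆-antisym ∩-⊆ˡ (∩-greatest ⊆-refl A⊆B)

⁅⁆-⊆ : e ∈ A → ⁅ e ⁆ ⊆ A
⁅⁆-⊆ {e = e} {A} e∈A x∈⁅e⁆ = subst (_∈ A) (sym (x∈⁅y⁆⇒x≡y e x∈⁅e⁆)) e∈A

x∈p─q⇒x∉q : e ∈ A ─ B → e ∉ B
x∈p─q⇒x∉q {e = Fin.zero}  {A = _ ∷ _} {B = inside ∷ _}  ()
x∈p─q⇒x∉q {e = Fin.zero}  {A = _ ∷ _} {B = outside ∷ _} _ ()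
x∈p─q⇒x∉q {e = Fin.suc _} {A = _ ∷ _} {B = _ ∷ _} (there e∈) (there e∈B) = x∈p─q⇒x∉q e∈ e∈B

x∈p∪q∧x∉p⇒x∈q : e ∈ A ∪ B → e ∉ A → e ∈ B
x∈p∪q∧x∉p⇒x∈q {A = A} {B = B} e∈A∪B e∉A = [ (λ e∈A → ⊥-elim (e∉A e∈A)) , (λ e∈B → e∈B) ] (x∈p∪q⁻ A B e∈A∪B)

∩-∩-distribʳ : (A ∩ C) ∩ (B ∩ C) ≡ (A ∩ B) ∩ C
∩-∩-distribʳ = ⊆-antisym
  (λ h → x∈p∩q⁺ (x∈p∩q⁺ (∩-⊆ˡ (∩-⊆ˡ h) , ∩-⊆ˡ (∩-⊆ʳ h)) , ∩-⊆ʳ (∩-⊆ˡ h)))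
  (λ h → x∈p∩q⁺ (x∈p∩q⁺ (∩-⊆ˡ (∩-⊆ˡ h) , ∩-⊆ʳ h) , x∈p∩q⁺ (∩-⊆ʳ (∩-⊆ˡ h) , ∩-⊆ʳ h)))

⊆⊎∃∉ : (A B : Subset n) → A ⊆ B ⊎ ∃ λ e → e ∈ A × e ∉ B
⊆⊎∃∉ A B with any? (λ e → (e ∈? A) ×-dec ¬? (e ∈? B))
... | yes witness = inj₂ witness
... | no ∄ = inj₁ λ {e} e∈A → decidable-stable (e ∈? B) (λ e∉B → ∄ (e , e∈A , e∉B))

∈⇒T-lookup : e ∈ A → T (lookup A e)
∈⇒T-lookup e∈A = Equivalence.from T-≡ ([]=⇒lookup e∈A)

T-lookup⇒∈ : T (lookup A e) → e ∈ A
T-lookup⇒∈ {A = A} {e = e} t = lookup⇒[]= e A (Equivalence.to T-≡ t)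

_∩ₗ_ : Subset n → List (Fin n) → Subset n
C ∩ₗ []      = ∅
C ∩ₗ (e ∷ l) with e ∈? C
... | yes _ = ⁅ e ⁆ ∪ (C ∩ₗ l)
... | no  _ = C ∩ₗ l

∩ₗ-⊆ : ∀ l → C ∩ₗ l ⊆ C
∩ₗ-⊆ []      = ⊥⊆
∩ₗ-⊆ {C = C} (e ∷ l) with e ∈? C
... | yes e∈C = ∪-least (⁅⁆-⊆ e∈C) (∩ₗ-⊆ l)
... | no  _   = ∩ₗ-⊆ l

∈-∩ₗ : ∀ l → e ∈ C → e ∈ₗ l → e ∈ C ∩ₗ l
∈-∩ₗ {C = C} (e ∷ l) e∈C (here refl) with e ∈? C
... | yes _   = ⊆-∪ˡ (x∈⁅x⁆ e)
... | no  e∉C = ⊥-elim (e∉C e∈C)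
∈-∩ₗ {C = C} (f ∷ l) e∈C (there e∈l) with f ∈? C
... | yes _ = ⊆-∪ʳ (∈-∩ₗ l e∈C e∈l)
... | no  _ = ∈-∩ₗ l e∈C e∈l

⊆-∩ₗ-allFin : C ⊆ C ∩ₗ allFin n
⊆-∩ₗ-allFin e∈C = ∈-∩ₗ _ e∈C (∈-allFin _)

-- Natural numbers

suc+≡+suc⇔ : ∀ {a b c d} → suc a + b ≡ c + suc d ⇔ a + b ≡ c + d
suc+≡+suc⇔ {c = c} {d} = mk⇔
  (λ eq → suc-injective (trans eq (+-suc c d)))
  (λ eq → trans (cong suc eq) (sym (+-suc c d)))

suc+suc≡suc+suc⇔ : ∀ {a b c d} → suc a + suc b ≡ suc c + suc d ⇔ a + b ≡ c + d
suc+suc≡suc+suc⇔ {a} {b} {c} {d} = mk⇔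
  (λ eq → suc-injective (suc-injective
            (trans (cong suc (sym (+-suc a b))) (trans eq (cong suc (+-suc c d))))))
  (λ eq → trans (cong suc (trans (+-suc a b) (cong suc eq))) (cong suc (sym (+-suc c d))))

≡-cong-⇔ : ∀ {p q p′ q′ : ℕ} → p ≡ p′ → q ≡ q′ → (p ≡ q) ⇔ (p′ ≡ q′)
≡-cong-⇔ p≡p′ q≡q′ = mk⇔ (λ eq → trans (sym p≡p′) (trans eq q≡q′)) (λ eq → trans p≡p′ (trans eq (sym q≡q′)))

¬1≤⇒≡0 : ∀ {m} → ¬ 1 ≤ m → m ≡ 0
¬1≤⇒≡0 1≰m = n≤0⇒n≡0 (≮⇒≥ 1≰m)

-- Matroids

module MatroidProperties (M : Pre n) (isMatroid : IsMatroid M) where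
  open IsMatroid isMatroid

  E : Subset n
  E = ground M

  r : Subset n → ℕ
  r = rk M

  private
    variable
      X Y F G : Subset n
      a b : Fin n

  ModularPair : Subset n → Subset n → Set
  ModularPair A B = r A + r B ≡ r (A ∩ B) + r (A ∪ B)

  modularPair-sym : ModularPair A B → ModularPair B A
  modularPair-sym {A = A} {B = B} eq =
    trans (+-comm (r B) (r A)) (trans eq (cong₂ _+_ (cong r (∩-comm A B)) (cong r (∪-comm A B))))

  rk-mono′ : A ⊆ B → B ⊆ E → r A ≤ r B
  rk-mono′ A⊆B B⊆E = rk-mono _ _ B⊆E A⊆B

  rk-submod′ : A ⊆ E → B ⊆ E → r (A ∪ B) + r (A ∩ B) ≤ r A + r B
  rk-submod′ = rk-submod _ _

  rk-∅ : r ∅ ≡ 0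
  rk-∅ = n≤0⇒n≡0 (≤-trans (rk-bounded ∅ ⊥⊆) (≤-reflexive (∣⊥∣≡0 n)))

  rk-⁅⁆≤1 : e ∈ E → r ⁅ e ⁆ ≤ 1
  rk-⁅⁆≤1 {e = e} e∈E = ≤-trans (rk-bounded ⁅ e ⁆ (⁅⁆-⊆ e∈E)) (≤-reflexive (∣⁅x⁆∣≡1 e))

  rk-∪≤+ : A ⊆ E → B ⊆ E → r (A ∪ B) ≤ r A + r B
  rk-∪≤+ A⊆E B⊆E = ≤-trans (m≤m+n _ _) (rk-submod′ A⊆E B⊆E)

  rk-∪⁅⁆≤suc : A ⊆ E → e ∈ E → r (A ∪ ⁅ e ⁆) ≤ suc (r A)
  rk-∪⁅⁆≤suc {A = A} A⊆E e∈E =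
    ≤-trans (rk-∪≤+ A⊆E (⁅⁆-⊆ e∈E))
            (≤-trans (+-monoʳ-≤ (r A) (rk-⁅⁆≤1 e∈E)) (≤-reflexive (+-comm (r A) 1)))

  rk-pair≤2 : a ∈ E → b ∈ E → r (⁅ a ⁆ ∪ ⁅ b ⁆) ≤ 2
  rk-pair≤2 a∈E b∈E = ≤-trans (rk-∪≤+ (⁅⁆-⊆ a∈E) (⁅⁆-⊆ b∈E)) (+-mono-≤ (rk-⁅⁆≤1 a∈E) (rk-⁅⁆≤1 b∈E))

  rk-cover⇒1≤rk-∩ : X ⊆ E → X ⊆ F ∪ G → 1 ≤ r X → 1 ≤ r (F ∩ X) ⊎ 1 ≤ r (G ∩ X)
  rk-cover⇒1≤rk-∩ {X = X} {F = F} {G = G} X⊆E X⊆F∪G 1≤rX with 1 ≤? r (F ∩ X) | 1 ≤? r (G ∩ X)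
  ... | yes 1≤rF∩X | _            = inj₁ 1≤rF∩X
  ... | no _       | yes 1≤rG∩X   = inj₂ 1≤rG∩X
  ... | no 1≰rF∩X  | no 1≰rG∩X    = ⊥-elim (<⇒≱ 1≤rX (begin
      r X                         ≤⟨ rk-mono′ (⊆-∪⇒⊆-∪∩ X⊆F∪G) parts⊆E ⟩
      r ((F ∩ X) ∪ (G ∩ X))       ≤⟨ rk-∪≤+ (λ h → X⊆E (∩-⊆ʳ h)) (λ h → X⊆E (∩-⊆ʳ h)) ⟩
      r (F ∩ X) + r (G ∩ X)       ≡⟨ cong₂ _+_ (¬1≤⇒≡0 1≰rF∩X) (¬1≤⇒≡0 1≰rG∩X) ⟩
      0                           ∎))
    where
      open ≤-Reasoning
      parts⊆E : (F ∩ X) ∪ (G ∩ X) ⊆ E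
      parts⊆E = ∪-least (λ h → X⊆E (∩-⊆ʳ h)) (λ h → X⊆E (∩-⊆ʳ h))

  -- An e ∈ B ∖ F would raise the rank of F, hence by submodularity the rank of A.
  flat-⊇-span : A ⊆ B → B ⊆ E → r B ≤ r A → Flat M F → A ⊆ F → B ⊆ F
  flat-⊇-span {A = A} {B = B} {F = F} A⊆B B⊆E rB≤rA (F⊆E , F-closed) A⊆F {e} e∈B with e ∈? F
  ... | yes e∈F = e∈F
  ... | no  e∉F = ⊥-elim (<⇒≱ (F-closed e (B⊆E e∈B) e∉F) (+-cancelʳ-≤ (r A) _ _ (begin
      r (F ∪ ⁅ e ⁆) + r A              ≤⟨ +-mono-≤ (rk-mono′ (∪-least ⊆-∪ˡ (λ h → ⊆-∪ʳ (⊆-∪ʳ h))) F∪Ae⊆E)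
                                                   (rk-mono′ (∩-greatest A⊆F ⊆-∪ˡ) (λ h → F⊆E (∩-⊆ˡ h))) ⟩
      r (F ∪ Ae) + r (F ∩ Ae)          ≤⟨ rk-submod′ F⊆E Ae⊆E ⟩
      r F + r Ae                       ≤⟨ +-monoʳ-≤ (r F) (≤-trans (rk-mono′ Ae⊆B B⊆E) rB≤rA) ⟩
      r F + r A                        ∎)))
    where
      open ≤-Reasoning
      Ae = A ∪ ⁅ e ⁆
      Ae⊆B : Ae ⊆ B
      Ae⊆B = ∪-least A⊆B (⁅⁆-⊆ e∈B)
      Ae⊆E : Ae ⊆ E
      Ae⊆E h = B⊆E (Ae⊆B h)
      F∪Ae⊆E : F ∪ Ae ⊆ E
      F∪Ae⊆E = ∪-least F⊆E Ae⊆E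

  ∈-cl⁻ : e ∈ cl M X → e ∈ E × r (X ∪ ⁅ e ⁆) ≡ r X
  ∈-cl⁻ {e = e} e∈cl with Equivalence.to T-∧ (subst T (lookup∘tabulate _ e) (∈⇒T-lookup e∈cl))
  ... | e∈E , rank-eq = T-lookup⇒∈ e∈E , ≡ᵇ⇒≡ _ _ rank-eq

  ∈-cl⁺ : e ∈ E → r (X ∪ ⁅ e ⁆) ≡ r X → e ∈ cl M X
  ∈-cl⁺ {e = e} e∈E rank-eq = T-lookup⇒∈
    (subst T (sym (lookup∘tabulate _ e)) (Equivalence.from T-∧ (∈⇒T-lookup e∈E , ≡⇒≡ᵇ _ _ rank-eq)))

  cl⊆E : cl M X ⊆ E
  cl⊆E e∈cl = proj₁ (∈-cl⁻ e∈cl)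

  cl-extensive : X ⊆ E → X ⊆ cl M X
  cl-extensive X⊆E e∈X = ∈-cl⁺ (X⊆E e∈X)
    (≤-antisym (rk-mono′ (∪-least ⊆-refl (⁅⁆-⊆ e∈X)) X⊆E) (rk-mono′ ⊆-∪ˡ (∪-least X⊆E (⁅⁆-⊆ (X⊆E e∈X)))))

  rk-∪-cl-step : X ⊆ E → Y ⊆ E → r (X ∪ Y) ≤ r X → e ∈ cl M X → r (X ∪ (⁅ e ⁆ ∪ Y)) ≤ r X
  rk-∪-cl-step {X = X} {Y = Y} {e = e} X⊆E Y⊆E rX∪Y≤rX e∈cl = +-cancelʳ-≤ (r X) _ _ (begin
      r (X ∪ (⁅ e ⁆ ∪ Y)) + r X        ≤⟨ +-mono-≤ (rk-mono′ ⊆-union (∪-least X∪Y⊆E X∪e⊆E))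
                                                   (rk-mono′ (∩-greatest ⊆-∪ˡ ⊆-∪ˡ) (λ h → X∪Y⊆E (∩-⊆ˡ h))) ⟩
      r ((X ∪ Y) ∪ (X ∪ ⁅ e ⁆)) + r ((X ∪ Y) ∩ (X ∪ ⁅ e ⁆)) ≤⟨ rk-submod′ X∪Y⊆E X∪e⊆E ⟩
      r (X ∪ Y) + r (X ∪ ⁅ e ⁆)        ≤⟨ +-mono-≤ rX∪Y≤rX (≤-reflexive (proj₂ (∈-cl⁻ e∈cl))) ⟩
      r X + r X                        ∎)
    where
      open ≤-Reasoning
      X∪Y⊆E : X ∪ Y ⊆ E
      X∪Y⊆E = ∪-least X⊆E Y⊆E
      X∪e⊆E : X ∪ ⁅ e ⁆ ⊆ E
      X∪e⊆E = ∪-least X⊆E (⁅⁆-⊆ (proj₁ (∈-cl⁻ e∈cl)))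
      ⊆-union : X ∪ (⁅ e ⁆ ∪ Y) ⊆ (X ∪ Y) ∪ (X ∪ ⁅ e ⁆)
      ⊆-union = ∪-least (λ h → ⊆-∪ˡ (⊆-∪ˡ h)) (∪-least (λ h → ⊆-∪ʳ (⊆-∪ʳ h)) (λ h → ⊆-∪ˡ (⊆-∪ʳ h)))

  rk-∪-∩ₗcl≤ : X ⊆ E → ∀ l → r (X ∪ (cl M X ∩ₗ l)) ≤ r X
  rk-∪-∩ₗcl≤ X⊆E []      = rk-mono′ (∪-least ⊆-refl ⊥⊆) X⊆E
  rk-∪-∩ₗcl≤ {X = X} X⊆E (e ∷ l) with e ∈? cl M X
  ... | yes e∈cl = rk-∪-cl-step X⊆E (λ h → cl⊆E (∩ₗ-⊆ l h)) (rk-∪-∩ₗcl≤ X⊆E l) e∈cl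
  ... | no  _    = rk-∪-∩ₗcl≤ X⊆E l

  rk-cl≤ : X ⊆ E → r (cl M X) ≤ r X
  rk-cl≤ X⊆E = ≤-trans
    (rk-mono′ (λ h → ⊆-∪ʳ (⊆-∩ₗ-allFin h)) (∪-least X⊆E (λ h → cl⊆E (∩ₗ-⊆ (allFin n) h))))
    (rk-∪-∩ₗcl≤ X⊆E (allFin n))

  cl-flat : X ⊆ E → Flat M (cl M X)
  cl-flat X⊆E = cl⊆E , λ e e∈E e∉cl → ≰⇒> λ rank≤ → e∉cl (∈-cl⁺ e∈E (≤-antisym
    (≤-trans (rk-mono′ (∪-least (λ h → ⊆-∪ˡ (cl-extensive X⊆E h)) ⊆-∪ʳ) (∪-least cl⊆E (⁅⁆-⊆ e∈E)))
             (≤-trans rank≤ (rk-cl≤ X⊆E)))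
    (rk-mono′ ⊆-∪ˡ (∪-least X⊆E (⁅⁆-⊆ e∈E)))))

  cl-least : X ⊆ E → Flat M F → X ⊆ F → cl M X ⊆ F
  cl-least X⊆E = flat-⊇-span (cl-extensive X⊆E) cl⊆E (rk-cl≤ X⊆E)

  cl-mono : X ⊆ Y → Y ⊆ E → cl M X ⊆ cl M Y
  cl-mono X⊆Y Y⊆E = cl-least (λ h → Y⊆E (X⊆Y h)) (cl-flat Y⊆E) (λ h → cl-extensive Y⊆E (X⊆Y h))

  flat-∩ : Flat M F → Flat M G → Flat M (F ∩ G)
  flat-∩ {F = F} {G = G} F-flat G-flat = (λ h → proj₁ F-flat (∩-⊆ˡ h)) , λ e e∈E e∉F∩G → ≰⇒> λ rank≤ →
    let F∩G∪e⊆E = ∪-least (λ h → proj₁ F-flat (∩-⊆ˡ h)) (⁅⁆-⊆ e∈E)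
        e∈F∩G∪e = ⊆-∪ʳ (x∈⁅x⁆ e)
    in e∉F∩G (x∈p∩q⁺ ( flat-⊇-span ⊆-∪ˡ F∩G∪e⊆E rank≤ F-flat ∩-⊆ˡ e∈F∩G∪e
                     , flat-⊇-span ⊆-∪ˡ F∩G∪e⊆E rank≤ G-flat ∩-⊆ʳ e∈F∩G∪e))

  flat-restrict : X ⊆ E → Flat M F → F ⊆ X → Flat (M ∣ʳ X) F
  flat-restrict X⊆E (_ , F-closed) F⊆X = F⊆X , λ e e∈X → F-closed e (X⊆E e∈X)

  flat-lift : Flat M G → Flat (M ∣ʳ G) F → Flat M F
  flat-lift {G = G} {F = F} G-flat (F⊆G , F-closed) = (λ h → proj₁ G-flat (F⊆G h)) , closed
    where
      closed : ∀ e → e ∈ E → e ∉ F → r F < r (F ∪ ⁅ e ⁆)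
      closed e e∈E e∉F with e ∈? G
      ... | yes e∈G = F-closed e e∈G e∉F
      ... | no  e∉G = ≰⇒> λ rank≤ → e∉G (flat-⊇-span ⊆-∪ˡ
              (∪-least (λ h → proj₁ G-flat (F⊆G h)) (⁅⁆-⊆ e∈E)) rank≤ G-flat F⊆G (⊆-∪ʳ (x∈⁅x⁆ e)))

  line : Fin n → Fin n → Subset n
  line a b = cl M (⁅ a ⁆ ∪ ⁅ b ⁆)

  pair⊆E : a ∈ E → b ∈ E → ⁅ a ⁆ ∪ ⁅ b ⁆ ⊆ E
  pair⊆E a∈E b∈E = ∪-least (⁅⁆-⊆ a∈E) (⁅⁆-⊆ b∈E)

  ∈line-left : a ∈ E → b ∈ E → a ∈ line a b
  ∈line-left {a = a} a∈E b∈E = cl-extensive (pair⊆E a∈E b∈E) (⊆-∪ˡ (x∈⁅x⁆ a))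

  ∈line-right : a ∈ E → b ∈ E → b ∈ line a b
  ∈line-right {b = b} a∈E b∈E = cl-extensive (pair⊆E a∈E b∈E) (⊆-∪ʳ (x∈⁅x⁆ b))

  line-⊆-flat : Flat M F → a ∈ F → b ∈ F → line a b ⊆ F
  line-⊆-flat F-flat@(F⊆E , _) a∈F b∈F =
    cl-least (pair⊆E (F⊆E a∈F) (F⊆E b∈F)) F-flat (∪-least (⁅⁆-⊆ a∈F) (⁅⁆-⊆ b∈F))

  rk-line≤2 : a ∈ E → b ∈ E → r (line a b) ≤ 2
  rk-line≤2 a∈E b∈E = ≤-trans (rk-cl≤ (pair⊆E a∈E b∈E)) (rk-pair≤2 a∈E b∈E)

-- Maximal round flats

flat? : (N : Pre n) → Decidable (Flat N)
flat? N F = (F ⊆? ground N) ×-dec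
  all? (λ e → (e ∈? ground N) →-dec (¬? (e ∈? F) →-dec (rk N F <? rk N (F ∪ ⁅ e ⁆))))

verticalCover? : (N : Pre n) → ∀ F F' → Dec (VerticalCover N F F')
verticalCover? N F F' = flat? N F ×-dec flat? N F' ×-dec ¬? (F ≟ₛ ground N) ×-dec
  ¬? (F' ≟ₛ ground N) ×-dec ((F ∪ F') ≟ₛ ground N)

round? : (N : Pre n) → Decidable (Round N)
round? N X = ¬? (anySubset? λ F → anySubset? λ F' → verticalCover? (N ∣ʳ X) F F')

Maximal : Pred (Subset n) ℓ → Pred (Subset n) ℓ
Maximal P Y = P Y × (∀ X → P X → Y ⊆ X → X ≡ Y)

module _ {P : Pred (Subset n) ℓ} (P? : Decidable P) where

  -- The fuel k bounds the number of strict enlargements still possible.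
  maximal-⊇ : P A → ∃ λ Y → Maximal P Y × A ⊆ Y
  maximal-⊇ {A = A₀} pA₀ = go n A₀ (m≤n+m n ∣ A₀ ∣) pA₀
    where
      go : ∀ k A → n ≤ ∣ A ∣ + k → P A → ∃ λ Y → Maximal P Y × A ⊆ Y
      go k A n≤∣A∣+k pA with anySubset? (λ X → P? X ×-dec (A ⊂? X))
      ... | no ∄larger = A , (pA , maximal) , ⊆-refl
        where
          maximal : ∀ X → P X → A ⊆ X → X ≡ A
          maximal X pX A⊆X with ⊆⊎∃∉ X A
          ... | inj₁ X⊆A               = ⊆-antisym X⊆A A⊆X
          ... | inj₂ (e , e∈X , e∉A) = ⊥-elim (∄larger (X , pX , A⊆X , e , e∈X , e∉A))
      go zero A n≤∣A∣+0 _ | yes (X , _ , A⊂X) =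
        ⊥-elim (<⇒≱ (p⊂q⇒∣p∣<∣q∣ A⊂X) (≤-trans (∣p∣≤n X) (≤-trans n≤∣A∣+0 (≤-reflexive (+-identityʳ _)))))
      go (suc k) A n≤∣A∣+1+k _ | yes (X , pX , A⊂X) with go k X n≤∣X∣+k pX
        where
          n≤∣X∣+k : n ≤ ∣ X ∣ + k
          n≤∣X∣+k = ≤-trans n≤∣A∣+1+k (≤-trans (≤-reflexive (+-suc ∣ A ∣ k)) (+-monoˡ-≤ k (p⊂q⇒∣p∣<∣q∣ A⊂X)))
      ... | Y , maxY , X⊆Y = Y , maxY , λ h → X⊆Y (p⊂q⇒p⊆q A⊂X h)

rotunda-⊇ : (N : Pre n) → Flat N A → Round N A → ∃ λ Y → Rotunda N Y × A ⊆ Y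
rotunda-⊇ N A-flat A-round with maximal-⊇ (λ X → flat? N X ×-dec round? N X) (A-flat , A-round)
... | Y , ((Y-flat , Y-round) , maximal) , A⊆Y =
  Y , (Y-flat , Y-round , λ X X-flat X-round → maximal X (X-flat , X-round)) , A⊆Y

ModularlySeparated : Pre n → Subset n → Subset n → Set
ModularlySeparated N X Y =
  ∃[ F₁ ] ∃[ F₂ ] ModularCover N F₁ F₂ × X ⊆ F₁ × Y ⊆ F₂ × F₁ ∩ F₂ ≡ X ∩ Y

modularCover-swap : {N : Pre n} → ModularCover N A B → ModularCover N B A
modularCover-swap {A = A} {B = B} ((A-flat , B-flat , A≢E , B≢E , A∪B≡E) , A-modular , B-modular) =
  (B-flat , A-flat , B≢E , A≢E , trans (∪-comm B A) A∪B≡E) , B-modular , A-modular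

separated-swap : {N : Pre n} → ModularlySeparated N A B → ModularlySeparated N B A
separated-swap {A = A} {B = B} (F₁ , F₂ , cover , A⊆F₁ , B⊆F₂ , F₁∩F₂≡A∩B) =
  F₂ , F₁ , modularCover-swap cover , B⊆F₂ , A⊆F₁ , trans (∩-comm F₂ F₁) (trans F₁∩F₂≡A∩B (∩-comm A B))

-- Splitting off a modular hyperplane

module ModularHyperplaneProperties (M : Pre n) (isMatroid : IsMatroid M) (H : Subset n)
                                   (H-modularHyperplane : ModularHyperplane M H) where
  open MatroidProperties M isMatroid public

  private
    variable
      X Y Z F F′ G K G₁ G₂ : Subset n
      a b : Fin n

  H-flat : Flat M H
  H-flat = proj₁ (proj₁ H-modularHyperplane)

  H-modular : ∀ F → Flat M F → ModularPair H F
  H-modular = proj₂ (proj₁ H-modularHyperplane)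

  H⊆E : H ⊆ E
  H⊆E = proj₁ H-flat

  suc-rk-H≡rk-E : suc (r H) ≡ r E
  suc-rk-H≡rk-E = proj₂ (proj₂ H-modularHyperplane)

  suc-rk≤rk-∪⁅⁆ : A ⊆ H → e ∈ E → e ∉ H → suc (r A) ≤ r (A ∪ ⁅ e ⁆)
  suc-rk≤rk-∪⁅⁆ {e = e} A⊆H e∈E e∉H = ≰⇒> λ rank≤ → e∉H
    (flat-⊇-span ⊆-∪ˡ (∪-least (λ h → H⊆E (A⊆H h)) (⁅⁆-⊆ e∈E)) rank≤ H-flat A⊆H (⊆-∪ʳ (x∈⁅x⁆ e)))

  -- H ∪ F spans E, so modularity of H computes r F.
  rk≡suc-rk-∩H : Flat M F → e ∈ F → e ∉ H → r F ≡ suc (r (F ∩ H))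
  rk≡suc-rk-∩H {F = F} {e = e} F-flat@(F⊆E , _) e∈F e∉H = +-cancelˡ-≡ (r H) _ _ (begin
      r H + r F                   ≡⟨ H-modular F F-flat ⟩
      r (H ∩ F) + r (H ∪ F)       ≡⟨ cong₂ _+_ (cong r (∩-comm H F)) rk-H∪F ⟩
      r (F ∩ H) + suc (r H)       ≡⟨ +-suc (r (F ∩ H)) (r H) ⟩
      suc (r (F ∩ H) + r H)       ≡⟨ cong suc (+-comm (r (F ∩ H)) (r H)) ⟩
      suc (r H + r (F ∩ H))       ≡⟨ sym (+-suc (r H) (r (F ∩ H))) ⟩
      r H + suc (r (F ∩ H))       ∎)
    where
      open ≡-Reasoning
      rk-H∪F : r (H ∪ F) ≡ suc (r H)
      rk-H∪F = ≤-antisym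
        (≤-trans (rk-mono′ (∪-least H⊆E F⊆E) ⊆-refl) (≤-reflexive (sym suc-rk-H≡rk-E)))
        (≤-trans (suc-rk≤rk-∪⁅⁆ ⊆-refl (F⊆E e∈F) e∉H)
                 (rk-mono′ (∪-least ⊆-∪ˡ (λ h → ⊆-∪ʳ (⁅⁆-⊆ e∈F h))) (∪-least H⊆E F⊆E)))

  rk≡suc-between : A ⊆ H → e ∈ E → e ∉ H → A ∪ ⁅ e ⁆ ⊆ Z → Z ⊆ cl M (A ∪ ⁅ e ⁆) → r Z ≡ suc (r A)
  rk≡suc-between {A = A} {e = e} A⊆H e∈E e∉H A∪e⊆Z Z⊆cl = ≤-antisym
    (≤-trans (rk-mono′ Z⊆cl cl⊆E) (≤-trans (rk-cl≤ A∪e⊆E) (rk-∪⁅⁆≤suc (λ h → H⊆E (A⊆H h)) e∈E)))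
    (≤-trans (suc-rk≤rk-∪⁅⁆ A⊆H e∈E e∉H) (rk-mono′ A∪e⊆Z (λ h → cl⊆E (Z⊆cl h))))
    where
      A∪e⊆E : A ∪ ⁅ e ⁆ ⊆ E
      A∪e⊆E = ∪-least (λ h → H⊆E (A⊆H h)) (⁅⁆-⊆ e∈E)

  flat-⊆-cl-∩H∪ : Flat M F → e ∈ F → e ∉ H → F ⊆ cl M ((F ∩ H) ∪ ⁅ e ⁆)
  flat-⊆-cl-∩H∪ {F = F} {e = e} F-flat@(F⊆E , _) e∈F e∉H =
    flat-⊇-span F∩H∪e⊆F F⊆E
      (≤-trans (≤-reflexive (rk≡suc-rk-∩H F-flat e∈F e∉H)) (suc-rk≤rk-∪⁅⁆ ∩-⊆ʳ (F⊆E e∈F) e∉H))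
      (cl-flat F∩H∪e⊆E) (cl-extensive F∩H∪e⊆E)
    where
      F∩H∪e⊆F : (F ∩ H) ∪ ⁅ e ⁆ ⊆ F
      F∩H∪e⊆F = ∪-least ∩-⊆ˡ (⁅⁆-⊆ e∈F)
      F∩H∪e⊆E : (F ∩ H) ∪ ⁅ e ⁆ ⊆ E
      F∩H∪e⊆E = λ h → F⊆E (F∩H∪e⊆F h)

  ⊆-cl-∩H∪ : Flat M G → e ∈ E → e ∉ H → G ⊆ H ⊎ e ∈ G → G ⊆ cl M ((G ∩ H) ∪ ⁅ e ⁆)
  ⊆-cl-∩H∪ (G⊆E , _) e∈E _ (inj₁ G⊆H) g∈G =
    cl-extensive (∪-least (λ h → G⊆E (∩-⊆ˡ h)) (⁅⁆-⊆ e∈E)) (⊆-∪ˡ (x∈p∩q⁺ (g∈G , G⊆H g∈G)))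
  ⊆-cl-∩H∪ G-flat _ e∉H (inj₂ e∈G) = flat-⊆-cl-∩H∪ G-flat e∈G e∉H

  rk-∪≡suc-rk-∩H : Flat M F → Flat M G → e ∈ F → e ∉ H → G ⊆ H ⊎ e ∈ G →
                   r (F ∪ G) ≡ suc (r ((F ∩ H) ∪ (G ∩ H)))
  rk-∪≡suc-rk-∩H {F = F} {G = G} {e = e} F-flat@(F⊆E , _) G-flat@(G⊆E , _) e∈F e∉H G-side =
    rk≡suc-between (∪-least ∩-⊆ʳ ∩-⊆ʳ) e∈E e∉H
      (∪-least (∪-least (λ h → ⊆-∪ˡ (∩-⊆ˡ h)) (λ h → ⊆-∪ʳ (∩-⊆ˡ h))) (λ h → ⊆-∪ˡ (⁅⁆-⊆ e∈F h)))
      (∪-least (λ h → cl-mono (∪-least (λ h′ → ⊆-∪ˡ (⊆-∪ˡ h′)) ⊆-∪ʳ) Z∪e⊆E (flat-⊆-cl-∩H∪ F-flat e∈F e∉H h))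
               (λ h → cl-mono (∪-least (λ h′ → ⊆-∪ˡ (⊆-∪ʳ h′)) ⊆-∪ʳ) Z∪e⊆E (⊆-cl-∩H∪ G-flat e∈E e∉H G-side h)))
    where
      e∈E = F⊆E e∈F
      Z∪e⊆E : ((F ∩ H) ∪ (G ∩ H)) ∪ ⁅ e ⁆ ⊆ E
      Z∪e⊆E = ∪-least (∪-least (λ h → F⊆E (∩-⊆ˡ h)) (λ h → G⊆E (∩-⊆ˡ h))) (⁅⁆-⊆ e∈E)

  -- Each of r F, r (F ∪ G) and, when e ∈ G, also r G and r (F ∩ G) exceeds
  -- its counterpart inside H by exactly one.
  modularPair⇔∩H : Flat M F → Flat M G → e ∈ F → e ∉ H → G ⊆ H ⊎ e ∈ G →
                   ModularPair F G ⇔ ModularPair (F ∩ H) (G ∩ H)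
  modularPair⇔∩H {F = F} {G = G} F-flat G-flat e∈F e∉H (inj₁ G⊆H) = ⇔-trans
    (≡-cong-⇔ (cong₂ _+_ (rk≡suc-rk-∩H F-flat e∈F e∉H) (cong r (sym (p⊆q⇒p∩q≡p G⊆H))))
              (cong₂ _+_ (cong r F∩G≡) (rk-∪≡suc-rk-∩H F-flat G-flat e∈F e∉H (inj₁ G⊆H))))
    (suc+≡+suc⇔ {r (F ∩ H)} {r (G ∩ H)})
    where
      F∩G≡ : F ∩ G ≡ (F ∩ H) ∩ (G ∩ H)
      F∩G≡ = trans (sym (p⊆q⇒p∩q≡p (λ h → G⊆H (∩-⊆ʳ h)))) (sym ∩-∩-distribʳ)
  modularPair⇔∩H {F = F} {G = G} F-flat G-flat e∈F e∉H (inj₂ e∈G) = ⇔-trans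
    (≡-cong-⇔ (cong₂ _+_ (rk≡suc-rk-∩H F-flat e∈F e∉H) (rk≡suc-rk-∩H G-flat e∈G e∉H))
              (cong₂ _+_ (trans (rk≡suc-rk-∩H (flat-∩ F-flat G-flat) (x∈p∩q⁺ (e∈F , e∈G)) e∉H)
                                (cong (λ S → suc (r S)) (sym ∩-∩-distribʳ)))
                         (rk-∪≡suc-rk-∩H F-flat G-flat e∈F e∉H (inj₂ e∈G))))
    (suc+suc≡suc+suc⇔ {r (F ∩ H)} {r (G ∩ H)})

  ⊇H-flat : Flat M F → H ⊆ F → F ≡ H ⊎ F ≡ E
  ⊇H-flat {F = F} F-flat@(F⊆E , _) H⊆F with ⊆⊎∃∉ F H
  ... | inj₁ F⊆H = inj₁ (⊆-antisym F⊆H H⊆F)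
  ... | inj₂ (e , e∈F , e∉H) = inj₂ (⊆-antisym F⊆E
    (flat-⊇-span H∪e⊆E ⊆-refl
       (≤-trans (≤-reflexive (sym suc-rk-H≡rk-E)) (suc-rk≤rk-∪⁅⁆ ⊆-refl (F⊆E e∈F) e∉H))
       F-flat (∪-least H⊆F (⁅⁆-⊆ e∈F))))
    where
      H∪e⊆E : H ∪ ⁅ e ⁆ ⊆ E
      H∪e⊆E = ∪-least H⊆E (⁅⁆-⊆ (F⊆E e∈F))

  modularFlat-∩H : ModularFlat M F → ModularFlat (M ∣ʳ H) (F ∩ H)
  modularFlat-∩H {F = F} (F-flat , F-modular) = flat-restrict H⊆E (flat-∩ F-flat H-flat) ∩-⊆ʳ , modular
    where
      modular : ∀ G → Flat (M ∣ʳ H) G → ModularPair (F ∩ H) G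
      modular G G-flatᴴ@(G⊆H , _) with ⊆⊎∃∉ F H | flat-lift H-flat G-flatᴴ
      ... | inj₁ F⊆H | G-flat = subst (λ S → ModularPair S G) (sym (p⊆q⇒p∩q≡p F⊆H)) (F-modular G G-flat)
      ... | inj₂ (e , e∈F , e∉H) | G-flat = subst (ModularPair (F ∩ H)) (p⊆q⇒p∩q≡p G⊆H)
        (Equivalence.to (modularPair⇔∩H F-flat G-flat e∈F e∉H (inj₁ G⊆H)) (F-modular G G-flat))

  modularFlat-lift : ModularFlat (M ∣ʳ H) G → ModularFlat M G
  modularFlat-lift {G = G} (G-flatᴴ@(G⊆H , _) , G-modular) = G-flat , modular
    where
      G-flat = flat-lift H-flat G-flatᴴ
      modular : ∀ K → Flat M K → ModularPair G K
      modular K K-flat with ⊆⊎∃∉ K H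
      ... | inj₁ K⊆H = G-modular K (flat-restrict H⊆E K-flat K⊆H)
      ... | inj₂ (e , e∈K , e∉H) = modularPair-sym
        (Equivalence.from (modularPair⇔∩H K-flat G-flat e∈K e∉H (inj₁ G⊆H))
          (subst (ModularPair (K ∩ H)) (sym (p⊆q⇒p∩q≡p G⊆H))
            (modularPair-sym (G-modular (K ∩ H) (flat-restrict H⊆E (flat-∩ K-flat H-flat) ∩-⊆ʳ)))))

  C* : Subset n
  C* = E ─ H

  R : Subset n
  R = Rᶜ M H

  W : Subset n
  W = R ∩ H

  C*⊆E : C* ⊆ E
  C*⊆E = p─q⊆p E H

  ∈C*⇒∉H : e ∈ C* → e ∉ H
  ∈C*⇒∉H = x∈p─q⇒x∉q

  ∈C*⁺ : e ∈ E → e ∉ H → e ∈ C*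
  ∈C*⁺ = x∈p∧x∉q⇒x∈p─q

  R-flat : Flat M R
  R-flat = cl-flat C*⊆E

  C*⊆R : C* ⊆ R
  C*⊆R = cl-extensive C*⊆E

  W-flat : Flat M W
  W-flat = flat-∩ R-flat H-flat

  W-flatᴴ : Flat (M ∣ʳ H) W
  W-flatᴴ = flat-restrict H⊆E W-flat ∩-⊆ʳ

  ∈H⊎∈C* : e ∈ E → e ∈ H ⊎ e ∈ C*
  ∈H⊎∈C* {e = e} e∈E with e ∈? H
  ... | yes e∈H = inj₁ e∈H
  ... | no  e∉H = inj₂ (∈C*⁺ e∈E e∉H)

  ⊆-of-∩H-and-R : X ⊆ E → X ∩ H ⊆ F → R ⊆ F → X ⊆ F
  ⊆-of-∩H-and-R X⊆E X∩H⊆F R⊆F e∈X =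
    [ (λ e∈H → X∩H⊆F (x∈p∩q⁺ (e∈X , e∈H))) , (λ e∈C* → R⊆F (C*⊆R e∈C*)) ] (∈H⊎∈C* (X⊆E e∈X))

  point-outside-H : ∃ λ x → x ∈ E × x ∉ H
  point-outside-H with ⊆⊎∃∉ E H
  ... | inj₁ E⊆H = ⊥-elim (<⇒≱ (≤-reflexive suc-rk-H≡rk-E) (rk-mono′ E⊆H H⊆E))
  ... | inj₂ witness = witness

  x₀ : Fin n
  x₀ = proj₁ point-outside-H

  x₀∈E : x₀ ∈ E
  x₀∈E = proj₁ (proj₂ point-outside-H)

  x₀∉H : x₀ ∉ H
  x₀∉H = proj₂ (proj₂ point-outside-H)

  x₀∈R : x₀ ∈ R
  x₀∈R = C*⊆R (∈C*⁺ x₀∈E x₀∉H)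

  -- Otherwise (X ∩ H , X ∩ R) would be a vertical cover of M | X.
  round-⊆R : Flat M X → Round M X → e ∈ X → e ∉ H → X ⊆ R
  round-⊆R {X = X} {e = e} X-flat@(X⊆E , _) X-round e∈X e∉H with ⊆⊎∃∉ X R
  ... | inj₁ X⊆R = X⊆R
  ... | inj₂ (f , f∈X , f∉R) = ⊥-elim (X-round (X ∩ H , X ∩ R ,
          flat-restrict X⊆E (flat-∩ X-flat H-flat) ∩-⊆ˡ , flat-restrict X⊆E (flat-∩ X-flat R-flat) ∩-⊆ˡ ,
          (λ X∩H≡X → e∉H (∩-⊆ʳ (subst (e ∈_) (sym X∩H≡X) e∈X))) ,
          (λ X∩R≡X → f∉R (∩-⊆ʳ (subst (f ∈_) (sym X∩R≡X) f∈X))) ,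
          ⊆-antisym (∪-least ∩-⊆ˡ ∩-⊆ˡ) X⊆X∩H∪X∩R))
    where
      X⊆X∩H∪X∩R : X ⊆ (X ∩ H) ∪ (X ∩ R)
      X⊆X∩H∪X∩R e∈X = [ (λ e∈H → ⊆-∪ˡ (x∈p∩q⁺ (e∈X , e∈H))) , (λ e∈C* → ⊆-∪ʳ (x∈p∩q⁺ (e∈X , C*⊆R e∈C*))) ]
                        (∈H⊎∈C* (X⊆E e∈X))

  1≤rk-⁅⁆ : e ∈ E → e ∉ H → 1 ≤ r ⁅ e ⁆
  1≤rk-⁅⁆ {e = e} e∈E e∉H = ≤-trans
    (subst (λ k → suc k ≤ r (∅ ∪ ⁅ e ⁆)) rk-∅ (suc-rk≤rk-∪⁅⁆ ⊥⊆ e∈E e∉H))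
    (rk-mono′ (∪-least ⊥⊆ ⊆-refl) (⁅⁆-⊆ e∈E))

  2≤rk-pair : Flat M F → a ∈ F → a ∉ H → b ∈ E → b ∉ F → 2 ≤ r (⁅ a ⁆ ∪ ⁅ b ⁆)
  2≤rk-pair {b = b} F-flat@(F⊆E , _) a∈F a∉H b∈E b∉F = ≤-trans (s≤s (1≤rk-⁅⁆ (F⊆E a∈F) a∉H))
    (≰⇒> λ rank≤ → b∉F (flat-⊇-span ⊆-∪ˡ (pair⊆E (F⊆E a∈F) b∈E) rank≤ F-flat (⁅⁆-⊆ a∈F) (⊆-∪ʳ (x∈⁅x⁆ b))))

  ⊆-flat-of-rk≤2 : Flat M F → e ∈ F → e ∈ X → e ∉ H → X ⊆ E → r X ≤ 2 → 1 ≤ r (F ∩ (X ∩ H)) → X ⊆ F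
  ⊆-flat-of-rk≤2 F-flat@(F⊆E , _) e∈F e∈X e∉H X⊆E rX≤2 1≤rk =
    flat-⊇-span (∪-least (λ h → ∩-⊆ˡ (∩-⊆ʳ h)) (⁅⁆-⊆ e∈X)) X⊆E
      (≤-trans rX≤2 (≤-trans (s≤s 1≤rk) (suc-rk≤rk-∪⁅⁆ (λ h → ∩-⊆ʳ (∩-⊆ʳ h)) (F⊆E e∈F) e∉H)))
      F-flat (∪-least ∩-⊆ˡ (⁅⁆-⊆ e∈F))

  -- As r (line a b ∩ H) ≥ 1, one of F, G meets it in positive rank; with a point
  -- of the line off H, that flat spans the whole line.
  line-⊆-one-of : a ∈ C* → b ∈ C* → 2 ≤ r (⁅ a ⁆ ∪ ⁅ b ⁆) → Flat M F → Flat M G →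
                  a ∈ F ⊎ b ∈ F → a ∈ G ⊎ b ∈ G → line a b ∩ H ⊆ F ∪ G → line a b ⊆ F ⊎ line a b ⊆ G
  line-⊆-one-of {a = a} {b = b} a∈C* b∈C* 2≤rk F-flat G-flat a/b∈F a/b∈G cover =
    ⊎-map (absorb F-flat a/b∈F) (absorb G-flat a/b∈G)
          (rk-cover⇒1≤rk-∩ (λ h → cl⊆E (∩-⊆ˡ h)) cover 1≤rk-line∩H)
    where
      a∈E = C*⊆E a∈C*
      b∈E = C*⊆E b∈C*
      1≤rk-line∩H : 1 ≤ r (line a b ∩ H)
      1≤rk-line∩H = ≤-pred (≤-trans 2≤rk (≤-trans (rk-mono′ (cl-extensive (pair⊆E a∈E b∈E)) cl⊆E)
        (≤-reflexive (rk≡suc-rk-∩H (cl-flat (pair⊆E a∈E b∈E)) (∈line-left a∈E b∈E) (∈C*⇒∉H a∈C*)))))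
      absorb : Flat M K → a ∈ K ⊎ b ∈ K → 1 ≤ r (K ∩ (line a b ∩ H)) → line a b ⊆ K
      absorb K-flat (inj₁ a∈K) =
        ⊆-flat-of-rk≤2 K-flat a∈K (∈line-left a∈E b∈E) (∈C*⇒∉H a∈C*) cl⊆E (rk-line≤2 a∈E b∈E)
      absorb K-flat (inj₂ b∈K) =
        ⊆-flat-of-rk≤2 K-flat b∈K (∈line-right a∈E b∈E) (∈C*⇒∉H b∈C*) cl⊆E (rk-line≤2 a∈E b∈E)

  ∃C*∖ : Flat (M ∣ʳ R) F → F ≢ R → ∃ λ e → e ∈ C* × e ∉ F
  ∃C*∖ F-flatᴿ F≢R with ⊆⊎∃∉ C* _
  ... | inj₁ C*⊆F = ⊥-elim (F≢R (⊆-antisym (proj₁ F-flatᴿ) (cl-least C*⊆E (flat-lift R-flat F-flatᴿ) C*⊆F)))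
  ... | inj₂ witness = witness

  R-round : Round M R
  R-round (F , F′ , F-flatᴿ , F′-flatᴿ , F≢R , F′≢R , F∪F′≡R)
    with ∃C*∖ F-flatᴿ F≢R | ∃C*∖ F′-flatᴿ F′≢R
  ... | a , a∈C* , a∉F | b , b∈C* , b∉F′ =
    [ (λ line⊆F → a∉F (line⊆F (∈line-left a∈E b∈E))) , (λ line⊆F′ → b∉F′ (line⊆F′ (∈line-right a∈E b∈E))) ]
      (line-⊆-one-of a∈C* b∈C* (2≤rk-pair F′-flat a∈F′ (∈C*⇒∉H a∈C*) b∈E b∉F′) F-flat F′-flat
                     (inj₂ b∈F) (inj₁ a∈F′) (λ h → R⊆F∪F′ (line⊆R (∩-⊆ˡ h))))
    where
      F-flat = flat-lift R-flat F-flatᴿ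
      F′-flat = flat-lift R-flat F′-flatᴿ
      a∈E = C*⊆E a∈C*
      b∈E = C*⊆E b∈C*
      R⊆F∪F′ : R ⊆ F ∪ F′
      R⊆F∪F′ = subst (R ⊆_) (sym F∪F′≡R) ⊆-refl
      a∈F′ = x∈p∪q∧x∉p⇒x∈q (R⊆F∪F′ (C*⊆R a∈C*)) a∉F
      b∈F = x∈p∪q∧x∉p⇒x∈q (subst (b ∈_) (∪-comm F F′) (R⊆F∪F′ (C*⊆R b∈C*))) b∉F′
      line⊆R = line-⊆-flat R-flat (C*⊆R a∈C*) (C*⊆R b∈C*)

  extend : Subset n → Subset n
  extend A = cl M (A ∪ ⁅ x₀ ⁆)

  module _ {A : Subset n} (A⊆H : A ⊆ H) where
    private
      A∪x₀⊆E : A ∪ ⁅ x₀ ⁆ ⊆ E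
      A∪x₀⊆E = ∪-least (λ h → H⊆E (A⊆H h)) (⁅⁆-⊆ x₀∈E)

    extend-flat : Flat M (extend A)
    extend-flat = cl-flat A∪x₀⊆E

    ⊆-extend : A ⊆ extend A
    ⊆-extend h = cl-extensive A∪x₀⊆E (⊆-∪ˡ h)

    x₀∈extend : x₀ ∈ extend A
    x₀∈extend = cl-extensive A∪x₀⊆E (⊆-∪ʳ (x∈⁅x⁆ x₀))

    rk-extend : r (extend A) ≡ suc (r A)
    rk-extend = rk≡suc-between A⊆H x₀∈E x₀∉H (cl-extensive A∪x₀⊆E) ⊆-refl

    extend-∩H : Flat M A → extend A ∩ H ≡ A
    extend-∩H A-flat = ⊆-antisym
      (flat-⊇-span A⊆extend∩H (λ h → cl⊆E (∩-⊆ˡ h)) (≤-reflexive rk-extend∩H) A-flat ⊆-refl)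
      A⊆extend∩H
      where
        A⊆extend∩H : A ⊆ extend A ∩ H
        A⊆extend∩H = ∩-greatest ⊆-extend A⊆H
        rk-extend∩H : r (extend A ∩ H) ≡ r A
        rk-extend∩H = suc-injective (trans (sym (rk≡suc-rk-∩H extend-flat x₀∈extend x₀∉H)) rk-extend)

    extend-least : Flat M F → A ⊆ F → x₀ ∈ F → extend A ⊆ F
    extend-least F-flat A⊆F x₀∈F = cl-least A∪x₀⊆E F-flat (∪-least A⊆F (⁅⁆-⊆ x₀∈F))

    R⊆extend : W ⊆ A → R ⊆ extend A
    R⊆extend W⊆A e∈R = cl-mono (∪-mono W⊆A ⊆-refl) A∪x₀⊆E (flat-⊆-cl-∩H∪ R-flat x₀∈R x₀∉H e∈R)

  R⊆extend-∪ : F ⊆ H → F′ ⊆ H → W ⊆ F ∪ F′ → R ⊆ extend F ∪ extend F′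
  R⊆extend-∪ {F = F} {F′ = F′} F⊆H F′⊆H W⊆F∪F′ {e} e∈R with ∈H⊎∈C* (cl⊆E e∈R)
  ... | inj₁ e∈H = W⊆extendF∪extendF′ (x∈p∩q⁺ (e∈R , e∈H))
    where
      W⊆extendF∪extendF′ : W ⊆ extend F ∪ extend F′
      W⊆extendF∪extendF′ h = ∪-mono (⊆-extend F⊆H) (⊆-extend F′⊆H) (W⊆F∪F′ h)
  ... | inj₂ e∈C* with e ∈? extend F
  ...   | yes e∈extendF = ⊆-∪ˡ e∈extendF
  ...   | no  e∉extendF =
    [ (λ line⊆extendF → ⊥-elim (e∉extendF (line⊆extendF e∈line)))
    , (λ line⊆extendF′ → ⊆-∪ʳ (line⊆extendF′ e∈line)) ]
      (line-⊆-one-of x₀∈C* e∈C* (2≤rk-pair (extend-flat F⊆H) (x₀∈extend F⊆H) x₀∉H e∈E e∉extendF)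
                     (extend-flat F⊆H) (extend-flat F′⊆H) (inj₁ (x₀∈extend F⊆H)) (inj₁ (x₀∈extend F′⊆H))
                     (λ h → ∪-mono (⊆-extend F⊆H) (⊆-extend F′⊆H)
                              (W⊆F∪F′ (x∈p∩q⁺ (line-⊆-flat R-flat x₀∈R e∈R (∩-⊆ˡ h) , ∩-⊆ʳ h)))))
    where
      x₀∈C* = ∈C*⁺ x₀∈E x₀∉H
      e∈E = C*⊆E e∈C*
      e∈line = ∈line-right x₀∈E e∈E

  W-round : Round M W
  W-round (F , F′ , F-flatᵂ , F′-flatᵂ , F≢W , F′≢W , F∪F′≡W) =
    R-round (extend F , extend F′ , extend-flatᴿ F-flatᵂ , extend-flatᴿ F′-flatᵂ ,
             extend≢R F-flatᵂ F≢W , extend≢R F′-flatᵂ F′≢W ,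
             ⊆-antisym (∪-least (extend⊆R F-flatᵂ) (extend⊆R F′-flatᵂ))
                       (R⊆extend-∪ (⊆H F-flatᵂ) (⊆H F′-flatᵂ) (subst (W ⊆_) (sym F∪F′≡W) ⊆-refl)))
    where
      ⊆H : Flat (M ∣ʳ W) A → A ⊆ H
      ⊆H (A⊆W , _) h = ∩-⊆ʳ (A⊆W h)

      extend⊆R : Flat (M ∣ʳ W) A → extend A ⊆ R
      extend⊆R A-flatᵂ@(A⊆W , _) = extend-least (⊆H A-flatᵂ) R-flat (λ h → ∩-⊆ˡ (A⊆W h)) x₀∈R

      extend-flatᴿ : Flat (M ∣ʳ W) A → Flat (M ∣ʳ R) (extend A)
      extend-flatᴿ A-flatᵂ = flat-restrict cl⊆E (extend-flat (⊆H A-flatᵂ)) (extend⊆R A-flatᵂ)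

      extend≢R : Flat (M ∣ʳ W) A → A ≢ W → extend A ≢ R
      extend≢R A-flatᵂ A≢W extend≡R =
        A≢W (trans (sym (extend-∩H (⊆H A-flatᵂ) (flat-lift W-flat A-flatᵂ))) (cong (_∩ H) extend≡R))

  R-rotunda : Rotunda M R
  R-rotunda = R-flat , R-round , λ X X-flat X-round R⊆X →
    ⊆-antisym (round-⊆R X-flat X-round (R⊆X x₀∈R) x₀∉H) R⊆X

  rotunda-meeting-C*≡R : Rotunda M X → e ∈ X → e ∉ H → X ≡ R
  rotunda-meeting-C*≡R (X-flat , X-round , X-max) e∈X e∉H =
    sym (X-max R R-flat R-round (round-⊆R X-flat X-round e∈X e∉H))

  rotunda-⊆H : Rotunda M X → X ≢ R → X ⊆ H
  rotunda-⊆H {X = X} X-rotunda X≢R with ⊆⊎∃∉ X H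
  ... | inj₁ X⊆H = X⊆H
  ... | inj₂ (e , e∈X , e∉H) = ⊥-elim (X≢R (rotunda-meeting-C*≡R X-rotunda e∈X e∉H))

  rotunda-restrict : Rotunda M X → X ≢ R → Rotunda (M ∣ʳ H) X
  rotunda-restrict X-rotunda@(X-flat , X-round , X-max) X≢R =
    flat-restrict H⊆E X-flat (rotunda-⊆H X-rotunda X≢R) , X-round ,
    λ Z Z-flatᴴ → X-max Z (flat-lift H-flat Z-flatᴴ)

  rotunda≢W : Rotunda M X → X ≢ R → X ≢ W
  rotunda≢W (_ , _ , X-max) X≢R X≡W =
    X≢R (sym (X-max R R-flat R-round (λ h → ∩-⊆ˡ (subst (_ ∈_) X≡W h))))

  rotunda-lift : Rotunda (M ∣ʳ H) X → X ≢ W → Rotunda M X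
  rotunda-lift {X = X} (X-flatᴴ@(X⊆H , _) , X-round , X-max) X≢W =
    flat-lift H-flat X-flatᴴ , X-round , maximal
    where
      maximal : ∀ Z → Flat M Z → Round M Z → X ⊆ Z → Z ≡ X
      maximal Z Z-flat Z-round X⊆Z with ⊆⊎∃∉ Z H
      ... | inj₁ Z⊆H = X-max Z (flat-restrict H⊆E Z-flat Z⊆H) Z-round X⊆Z
      ... | inj₂ (e , e∈Z , e∉H) = ⊥-elim (X≢W (sym (X-max W W-flatᴴ W-round
              (∩-greatest (λ h → round-⊆R Z-flat Z-round e∈Z e∉H (X⊆Z h)) X⊆H))))

  rotunda⇔ : ∀ X → Rotunda M X ⇔ ((Rotunda (M ∣ʳ H) X × X ≢ W) ⊎ X ≡ R)
  rotunda⇔ X = mk⇔ to from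
    where
      to : Rotunda M X → (Rotunda (M ∣ʳ H) X × X ≢ W) ⊎ X ≡ R
      to X-rotunda with X ≟ₛ R
      ... | yes X≡R = inj₂ X≡R
      ... | no  X≢R = inj₁ (rotunda-restrict X-rotunda X≢R , rotunda≢W X-rotunda X≢R)
      from : (Rotunda (M ∣ʳ H) X × X ≢ W) ⊎ X ≡ R → Rotunda M X
      from (inj₁ (X-rotundaᴴ , X≢W)) = rotunda-lift X-rotundaᴴ X≢W
      from (inj₂ X≡R) = subst (Rotunda M) (sym X≡R) R-rotunda

  rotunda⇔-of-¬W : ¬ Rotunda (M ∣ʳ H) W → ∀ X → Rotunda M X ⇔ (Rotunda (M ∣ʳ H) X ⊎ X ≡ R)
  rotunda⇔-of-¬W W-not-rotunda X = ⇔-trans (rotunda⇔ X) (mk⇔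
    [ (λ (X-rotundaᴴ , _) → inj₁ X-rotundaᴴ) , inj₂ ]
    [ (λ X-rotundaᴴ → inj₁ (X-rotundaᴴ , λ X≡W → W-not-rotunda (subst (Rotunda (M ∣ʳ H)) X≡W X-rotundaᴴ)))
    , inj₂ ])

  ¬rotunda-of-⊂ : (∃ λ Y → Rotunda (M ∣ʳ H) Y × W ⊂ Y) → ¬ Rotunda (M ∣ʳ H) W
  ¬rotunda-of-⊂ (Y , (Y-flat , Y-round , _) , W⊆Y , e , e∈Y , e∉W) (_ , _ , W-max) =
    e∉W (subst (e ∈_) (W-max Y Y-flat Y-round W⊆Y) e∈Y)

  caseA⊎caseB : CaseA M H ⊎ CaseB M H
  caseA⊎caseB with rotunda-⊇ (M ∣ʳ H) W-flatᴴ W-round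
  ... | Y , Y-rotunda , W⊆Y with ⊆⊎∃∉ Y W
  ...   | inj₁ Y⊆W = inj₁ (subst (Rotunda (M ∣ʳ H)) (⊆-antisym Y⊆W W⊆Y) Y-rotunda , rotunda⇔)
  ...   | inj₂ (e , e∈Y , e∉W) = inj₂ (W⊂Y , rotunda⇔-of-¬W (¬rotunda-of-⊂ W⊂Y))
    where
      W⊂Y : ∃ λ Y → Rotunda (M ∣ʳ H) Y × W ⊂ Y
      W⊂Y = Y , Y-rotunda , W⊆Y , e , e∈Y , e∉W

  ¬caseA×caseB : ¬ (CaseA M H × CaseB M H)
  ¬caseA×caseB ((W-rotunda , _) , (W⊂Y , _)) = ¬rotunda-of-⊂ W⊂Y W-rotunda

  rotundas-∩⊆H : Rotunda M X → Rotunda M Y → X ≢ Y → X ∩ Y ⊆ H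
  rotundas-∩⊆H X-rotunda Y-rotunda X≢Y {e} e∈X∩Y with e ∈? H
  ... | yes e∈H = e∈H
  ... | no  e∉H = ⊥-elim (X≢Y (trans (rotunda-meeting-C*≡R X-rotunda (∩-⊆ˡ e∈X∩Y) e∉H)
                                     (sym (rotunda-meeting-C*≡R Y-rotunda (∩-⊆ʳ e∈X∩Y) e∉H))))

  rotundas-∩H-∩H≡∩ : Rotunda M X → Rotunda M Y → X ≢ Y → (X ∩ H) ∩ (Y ∩ H) ≡ X ∩ Y
  rotundas-∩H-∩H≡∩ X-rotunda Y-rotunda X≢Y =
    trans ∩-∩-distribʳ (p⊆q⇒p∩q≡p (rotundas-∩⊆H X-rotunda Y-rotunda X≢Y))

  rotunda-∩H-injective : Rotunda M X → Rotunda M Y → X ∩ H ≡ Y ∩ H → X ≡ Y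
  rotunda-∩H-injective {X = X} {Y = Y} X-rotunda@(X-flat , X-round , X-max) Y-rotunda@(Y-flat , Y-round , Y-max)
                       X∩H≡Y∩H with ⊆⊎∃∉ X H | ⊆⊎∃∉ Y H
  ... | inj₁ X⊆H | _ =
    sym (X-max Y Y-flat Y-round (λ h → ∩-⊆ˡ (subst (_ ∈_) X∩H≡Y∩H (x∈p∩q⁺ (h , X⊆H h)))))
  ... | inj₂ _ | inj₁ Y⊆H =
    Y-max X X-flat X-round (λ h → ∩-⊆ˡ (subst (_ ∈_) (sym X∩H≡Y∩H) (x∈p∩q⁺ (h , Y⊆H h))))
  ... | inj₂ (e , e∈X , e∉H) | inj₂ (f , f∈Y , f∉H) =
    trans (rotunda-meeting-C*≡R X-rotunda e∈X e∉H) (sym (rotunda-meeting-C*≡R Y-rotunda f∈Y f∉H))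

  rotunda-∩H-restrict : Rotunda M X → X ≢ R → Rotunda (M ∣ʳ H) (X ∩ H)
  rotunda-∩H-restrict X-rotunda X≢R =
    subst (Rotunda (M ∣ʳ H)) (sym (p⊆q⇒p∩q≡p (rotunda-⊆H X-rotunda X≢R))) (rotunda-restrict X-rotunda X≢R)

  -- If F = H, then X is a round flat of M | H containing the rotunda Y ∩ H, so
  -- X = Y ∩ H ⊆ Y, and maximality of X gives X = Y.
  separating-flat≢H : Rotunda M X → Rotunda M Y → X ≢ Y → Rotunda (M ∣ʳ H) (Y ∩ H) →
                      X ⊆ F → Y ⊆ G → F ∩ G ≡ X ∩ Y → F ≢ H
  separating-flat≢H {X = X} {Y = Y} (X-flat , X-round , X-max) (Y-flat , Y-round , _) X≢Y
                    (_ , _ , Y∩H-max) X⊆F Y⊆G F∩G≡X∩Y F≡H =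
    X≢Y (sym (X-max Y Y-flat Y-round (λ h → ∩-⊆ˡ (subst (_ ∈_) X≡Y∩H h))))
    where
      X⊆H : X ⊆ H
      X⊆H h = subst (_ ∈_) F≡H (X⊆F h)
      Y∩H⊆X : Y ∩ H ⊆ X
      Y∩H⊆X h = ∩-⊆ˡ (subst (_ ∈_) F∩G≡X∩Y (x∈p∩q⁺ (subst (_ ∈_) (sym F≡H) (∩-⊆ʳ h) , Y⊆G (∩-⊆ˡ h))))
      X≡Y∩H : X ≡ Y ∩ H
      X≡Y∩H = Y∩H-max X (flat-restrict H⊆E X-flat X⊆H) X-round Y∩H⊆X

  ∩H≢H : Flat M F → F ≢ H → F ≢ E → F ∩ H ≢ H
  ∩H≢H F-flat F≢H F≢E F∩H≡H = [ F≢H , F≢E ] (⊇H-flat F-flat (λ h → ∩-⊆ˡ (subst (_ ∈_) (sym F∩H≡H) h)))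

  modularCover-∩H : ModularCover M F G → F ≢ H → G ≢ H → ModularCover (M ∣ʳ H) (F ∩ H) (G ∩ H)
  modularCover-∩H ((F-flat , G-flat , F≢E , G≢E , F∪G≡E) , F-modular , G-modular) F≢H G≢H =
    ( proj₁ F∩H-modular , proj₁ G∩H-modular , ∩H≢H F-flat F≢H F≢E , ∩H≢H G-flat G≢H G≢E
    , ⊆-antisym (∪-least ∩-⊆ʳ ∩-⊆ʳ) (⊆-∪⇒⊆-∪∩ (λ h → subst (_ ∈_) (sym F∪G≡E) (H⊆E h))))
    , F∩H-modular , G∩H-modular
    where
      F∩H-modular = modularFlat-∩H F-modular
      G∩H-modular = modularFlat-∩H G-modular

  separated⇒separatedᴴ : Rotunda M X → Rotunda M Y → X ≢ Y →
                         Rotunda (M ∣ʳ H) (X ∩ H) → Rotunda (M ∣ʳ H) (Y ∩ H) →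
                         ModularlySeparated M X Y → ModularlySeparated (M ∣ʳ H) (X ∩ H) (Y ∩ H)
  separated⇒separatedᴴ {X = X} {Y = Y} X-rotunda Y-rotunda X≢Y X∩H-rotunda Y∩H-rotunda
                       (F , G , cover , X⊆F , Y⊆G , F∩G≡X∩Y) =
    F ∩ H , G ∩ H ,
    modularCover-∩H cover (separating-flat≢H X-rotunda Y-rotunda X≢Y Y∩H-rotunda X⊆F Y⊆G F∩G≡X∩Y)
                          (separating-flat≢H Y-rotunda X-rotunda (λ Y≡X → X≢Y (sym Y≡X)) X∩H-rotunda Y⊆G X⊆F
                                             (trans (∩-comm G F) (trans F∩G≡X∩Y (∩-comm X Y)))) ,
    ∩-mono X⊆F ⊆-refl , ∩-mono Y⊆G ⊆-refl ,
    trans ∩-∩-distribʳ (trans (cong (_∩ H) F∩G≡X∩Y) (sym ∩-∩-distribʳ))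

  modularFlat-extend : ModularFlat (M ∣ʳ H) G → W ⊆ G → ModularFlat M (extend G)
  modularFlat-extend {G = G} (G-flatᴴ@(G⊆H , _) , G-modular) W⊆G = extendG-flat , modular
    where
      extendG-flat = extend-flat G⊆H
      modular-at : Flat M K → e ∈ extend G → e ∉ H → K ⊆ H ⊎ e ∈ K → ModularPair (extend G) K
      modular-at {K = K} K-flat e∈extendG e∉H K-side =
        Equivalence.from (modularPair⇔∩H extendG-flat K-flat e∈extendG e∉H K-side)
          (subst (λ S → ModularPair S (K ∩ H)) (sym (extend-∩H G⊆H (flat-lift H-flat G-flatᴴ)))
                 (G-modular (K ∩ H) (flat-restrict H⊆E (flat-∩ K-flat H-flat) ∩-⊆ʳ)))
      modular : ∀ K → Flat M K → ModularPair (extend G) K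
      modular K K-flat with ⊆⊎∃∉ K H
      ... | inj₁ K⊆H = modular-at K-flat (x₀∈extend G⊆H) x₀∉H (inj₁ K⊆H)
      ... | inj₂ (e , e∈K , e∉H) =
        modular-at K-flat (R⊆extend G⊆H W⊆G (C*⊆R (∈C*⁺ (proj₁ K-flat e∈K) e∉H))) e∉H (inj₂ e∈K)

  modularCover-extend : ModularCover (M ∣ʳ H) F G → W ⊆ F →
                        ModularCover M (extend F) G × extend F ∩ G ≡ F ∩ G
  modularCover-extend {F = F} {G = G}
    ((F-flatᴴ@(F⊆H , _) , G-flatᴴ@(G⊆H , _) , F≢H , G≢H , F∪G≡H) , F-modular , G-modular) W⊆F =
    ( ( extend-flat F⊆H , flat-lift H-flat G-flatᴴ , extendF≢E , G≢E
      , ⊆-antisym (∪-least cl⊆E (λ h → H⊆E (G⊆H h))) E⊆extendF∪G)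
    , modularFlat-extend F-modular W⊆F , modularFlat-lift G-modular)
    , ⊆-antisym (λ h → x∈p∩q⁺ (subst (_ ∈_) extendF∩H≡F (x∈p∩q⁺ (∩-⊆ˡ h , G⊆H (∩-⊆ʳ h))) , ∩-⊆ʳ h))
                (∩-mono (⊆-extend F⊆H) ⊆-refl)
    where
      extendF∩H≡F : extend F ∩ H ≡ F
      extendF∩H≡F = extend-∩H F⊆H (flat-lift H-flat F-flatᴴ)
      extendF≢E : extend F ≢ E
      extendF≢E extendF≡E =
        F≢H (trans (sym extendF∩H≡F) (trans (cong (_∩ H) extendF≡E) (trans (∩-comm E H) (p⊆q⇒p∩q≡p H⊆E))))
      G≢E : G ≢ E
      G≢E G≡E = x₀∉H (G⊆H (subst (x₀ ∈_) (sym G≡E) x₀∈E))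
      E⊆extendF∪G : E ⊆ extend F ∪ G
      E⊆extendF∪G = ⊆-of-∩H-and-R ⊆-refl
        (λ h → ∪-mono (⊆-extend F⊆H) ⊆-refl (subst (_ ∈_) (sym F∪G≡H) (∩-⊆ʳ h)))
        (λ h → ⊆-∪ˡ (R⊆extend F⊆H W⊆F h))

  W⊆-one-side : VerticalCover (M ∣ʳ H) F G → W ⊆ F ⊎ W ⊆ G
  W⊆-one-side {F = F} {G = G} (F-flatᴴ , G-flatᴴ , _ , _ , F∪G≡H) with (F ∩ W) ≟ₛ W | (G ∩ W) ≟ₛ W
  ... | yes F∩W≡W | _         = inj₁ (λ h → ∩-⊆ˡ (subst (_ ∈_) (sym F∩W≡W) h))
  ... | no  _     | yes G∩W≡W = inj₂ (λ h → ∩-⊆ˡ (subst (_ ∈_) (sym G∩W≡W) h))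
  ... | no  F∩W≢W | no  G∩W≢W = ⊥-elim (W-round
        ( F ∩ W , G ∩ W , restrictW F-flatᴴ , restrictW G-flatᴴ , F∩W≢W , G∩W≢W
        , ⊆-antisym (∪-least ∩-⊆ʳ ∩-⊆ʳ) (⊆-∪⇒⊆-∪∩ (λ h → subst (_ ∈_) (sym F∪G≡H) (∩-⊆ʳ h)))))
    where
      restrictW : Flat (M ∣ʳ H) A → Flat (M ∣ʳ W) (A ∩ W)
      restrictW A-flatᴴ = flat-restrict (λ h → cl⊆E (∩-⊆ˡ h)) (flat-∩ (flat-lift H-flat A-flatᴴ) W-flat) ∩-⊆ʳ

  W⊆-of-≡R : X ≡ R → X ∩ H ⊆ G → W ⊆ G
  W⊆-of-≡R refl X∩H⊆G = X∩H⊆G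

  W-side : ModularCover (M ∣ʳ H) G₁ G₂ → Rotunda M X → Rotunda M Y → X ≢ Y →
           X ∩ H ⊆ G₁ → Y ∩ H ⊆ G₂ → (W ⊆ G₁ × Y ⊆ H) ⊎ (W ⊆ G₂ × X ⊆ H)
  W-side {X = X} {Y = Y} cover X-rotunda Y-rotunda X≢Y X∩H⊆G₁ Y∩H⊆G₂ with ⊆⊎∃∉ X H | ⊆⊎∃∉ Y H
  ... | inj₂ (e , e∈X , e∉H) | _ =
    inj₁ (W⊆-of-≡R X≡R X∩H⊆G₁ , rotunda-⊆H Y-rotunda (λ Y≡R → X≢Y (trans X≡R (sym Y≡R))))
    where X≡R = rotunda-meeting-C*≡R X-rotunda e∈X e∉H
  ... | inj₁ X⊆H | inj₂ (e , e∈Y , e∉H) =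
    inj₂ (W⊆-of-≡R (rotunda-meeting-C*≡R Y-rotunda e∈Y e∉H) Y∩H⊆G₂ , X⊆H)
  ... | inj₁ X⊆H | inj₁ Y⊆H with W⊆-one-side (proj₁ cover)
  ...   | inj₁ W⊆G₁ = inj₁ (W⊆G₁ , Y⊆H)
  ...   | inj₂ W⊆G₂ = inj₂ (W⊆G₂ , X⊆H)

  separatedᴴ⇒separated-on-W-side : ModularCover (M ∣ʳ H) G₁ G₂ → W ⊆ G₁ → X ⊆ E → Y ⊆ H →
                                   X ∩ H ⊆ G₁ → Y ∩ H ⊆ G₂ → G₁ ∩ G₂ ≡ X ∩ Y → ModularlySeparated M X Y
  separatedᴴ⇒separated-on-W-side {G₁ = G₁} cover W⊆G₁ X⊆E Y⊆H X∩H⊆G₁ Y∩H⊆G₂ G₁∩G₂≡X∩Y =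
    extend G₁ , _ , proj₁ lifted ,
    ⊆-of-∩H-and-R X⊆E (λ h → ⊆-extend G₁⊆H (X∩H⊆G₁ h)) (R⊆extend G₁⊆H W⊆G₁) ,
    (λ h → Y∩H⊆G₂ (x∈p∩q⁺ (h , Y⊆H h))) , trans (proj₂ lifted) G₁∩G₂≡X∩Y
    where
      G₁⊆H = proj₁ (proj₁ (proj₁ cover))
      lifted = modularCover-extend cover W⊆G₁

  separatedᴴ⇒separated : Rotunda M X → Rotunda M Y → X ≢ Y →
                         ModularlySeparated (M ∣ʳ H) (X ∩ H) (Y ∩ H) → ModularlySeparated M X Y
  separatedᴴ⇒separated {X = X} {Y = Y} X-rotunda Y-rotunda X≢Y (G₁ , G₂ , cover , X∩H⊆G₁ , Y∩H⊆G₂ , G₁∩G₂≡)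
    with W-side cover X-rotunda Y-rotunda X≢Y X∩H⊆G₁ Y∩H⊆G₂
  ... | inj₁ (W⊆G₁ , Y⊆H) =
    separatedᴴ⇒separated-on-W-side cover W⊆G₁ (proj₁ (proj₁ X-rotunda)) Y⊆H X∩H⊆G₁ Y∩H⊆G₂ G₁∩G₂≡X∩Y
    where G₁∩G₂≡X∩Y = trans G₁∩G₂≡ (rotundas-∩H-∩H≡∩ X-rotunda Y-rotunda X≢Y)
  ... | inj₂ (W⊆G₂ , X⊆H) = separated-swap
    (separatedᴴ⇒separated-on-W-side (modularCover-swap cover) W⊆G₂ (proj₁ (proj₁ Y-rotunda)) X⊆H Y∩H⊆G₂ X∩H⊆G₁
       (trans (∩-comm G₂ G₁) (trans G₁∩G₂≡ (trans (rotundas-∩H-∩H≡∩ X-rotunda Y-rotunda X≢Y) (∩-comm X Y)))))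

  adj⇔adjᴴ : Rotunda M X → Rotunda M Y → Rotunda (M ∣ʳ H) (X ∩ H) → Rotunda (M ∣ʳ H) (Y ∩ H) →
             Adj M X Y ⇔ Adj (M ∣ʳ H) (X ∩ H) (Y ∩ H)
  adj⇔adjᴴ {X = X} {Y = Y} X-rotunda Y-rotunda X∩H-rotunda Y∩H-rotunda = mk⇔ to from
    where
      to : Adj M X Y → Adj (M ∣ʳ H) (X ∩ H) (Y ∩ H)
      to (_ , _ , X≢Y , (e , e∈X∩Y) , separated) =
        X∩H-rotunda , Y∩H-rotunda , (λ eq → X≢Y (rotunda-∩H-injective X-rotunda Y-rotunda eq)) ,
        (e , subst (e ∈_) (sym (rotundas-∩H-∩H≡∩ X-rotunda Y-rotunda X≢Y)) e∈X∩Y) ,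
        separated⇒separatedᴴ X-rotunda Y-rotunda X≢Y X∩H-rotunda Y∩H-rotunda separated
      from : Adj (M ∣ʳ H) (X ∩ H) (Y ∩ H) → Adj M X Y
      from (_ , _ , X∩H≢Y∩H , (e , e∈) , separatedᴴ) =
        X-rotunda , Y-rotunda , X≢Y , (e , subst (e ∈_) (rotundas-∩H-∩H≡∩ X-rotunda Y-rotunda X≢Y) e∈) ,
        separatedᴴ⇒separated X-rotunda Y-rotunda X≢Y separatedᴴ
        where
          X≢Y : X ≢ Y
          X≢Y X≡Y = X∩H≢Y∩H (cong (_∩ H) X≡Y)

  relabel≡∩H : Rotunda M X → relabel R H X ≡ X ∩ H
  relabel≡∩H {X = X} X-rotunda with ≡-dec Bool._≟_ X R
  ... | yes X≡R = cong (_∩ H) (sym X≡R)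
  ... | no  X≢R = sym (p⊆q⇒p∩q≡p (rotunda-⊆H X-rotunda X≢R))

  rotunda-∩H : Rotunda (M ∣ʳ H) W → Rotunda M X → Rotunda (M ∣ʳ H) (X ∩ H)
  rotunda-∩H {X = X} W-rotunda X-rotunda with X ≟ₛ R
  ... | yes X≡R = subst (λ S → Rotunda (M ∣ʳ H) (S ∩ H)) (sym X≡R) W-rotunda
  ... | no  X≢R = rotunda-∩H-restrict X-rotunda X≢R

  graphA : Rotunda (M ∣ʳ H) W → GraphA M H
  graphA W-rotunda X Y X-rotunda Y-rotunda =
    subst₂ (λ P Q → Adj M X Y ⇔ Adj (M ∣ʳ H) P Q) (sym (relabel≡∩H X-rotunda)) (sym (relabel≡∩H Y-rotunda))
      (adj⇔adjᴴ X-rotunda Y-rotunda (rotunda-∩H W-rotunda X-rotunda) (rotunda-∩H W-rotunda Y-rotunda))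

  graphB : GraphB M H
  graphB X Y X-rotunda Y-rotunda X≢R Y≢R =
    subst₂ (λ P Q → Adj M X Y ⇔ Adj (M ∣ʳ H) P Q)
      (p⊆q⇒p∩q≡p (rotunda-⊆H X-rotunda X≢R)) (p⊆q⇒p∩q≡p (rotunda-⊆H Y-rotunda Y≢R))
      (adj⇔adjᴴ X-rotunda Y-rotunda (rotunda-∩H-restrict X-rotunda X≢R) (rotunda-∩H-restrict Y-rotunda Y≢R))

mainTheorem18 : ∀ {n} (M : Pre n) → IsMatroid M → Supersolvable M → Saturated M →
    ∀ H → ModularHyperplane M H → Supersolvable (M ∣ʳ H) →
    Rotunda M (Rᶜ M H)
    × (CaseA M H ⊎ CaseB M H)
    × ¬ (CaseA M H × CaseB M H)
    × (CaseA M H → GraphA M H)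
    × (CaseB M H → GraphB M H)
mainTheorem18 M isMatroid _ _ H H-modularHyperplane _ =
  R-rotunda , caseA⊎caseB , ¬caseA×caseB , (λ caseA → graphA (proj₁ caseA)) , (λ _ → graphB)
  where open ModularHyperplaneProperties M isMatroid H H-modularHyperplane
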